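{- Let $q$ be a prime power and let $d$ be a positive divisor of $q-1$. Suppose there is no nontrivial permutation binomial over $\mathbb{F}_q$ of the form $x^e(x^d+a)$ with $e$ a nonnegative integer and $a\in\mathbb{F}_q$. Then there is no nontrivial permutation binomial over $\mathbb{F}_q$ of the form $x^n(x^k+a)$ with $n$ a nonnegative integer, $k$ a positive integer, $a\in\mathbb{F}_q$, and $\gcd(k,q-1)=d$.
   Context: A polynomial $f\in\mathbb{F}_q[x]$ is a permutation polynomial over $\mathbb{F}_q$ if the map $c\mapsto f(c)$ is a bijection of $\mathbb{F}_q$. A permutation binomial of $\mathbb{F}_q$ is called trivial if it is congruent modulo $x^q-x$ to the sum of a constant and a monomial; equivalently, the nontrivial permutation binomials are those binomials (two terms with nonzero coefficients) permuting $\mathbb{F}_q$ whose two terms have positive degrees that are incongruent modulo $q-1$. -}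

module Defs where

open import Level using (Level; _⊔_; suc)
open import Data.Nat as ℕ using (ℕ; zero; _∸_; _≥_)
open import Data.Nat.Divisibility using (_∣_)
open import Data.Nat.Primality using (Prime)
open import Data.Fin using (Fin)
open import Data.Product using (Σ; ∃; _×_; _,_)
open import Relation.Nullary using (¬_)
open import Relation.Binary.PropositionalEquality using (_≡_)
import Relation.Binary.PropositionalEquality as P
open import Algebra.Bundles using (CommutativeRing)
open import Function.Bundles using (Inverse)
open import Function.Definitions using (Bijective)

IsPrimePower : ℕ → Set
IsPrimePower q = Σ ℕ λ p → Σ ℕ λ m → Prime p × m ≥ 1 × q ≡ p ℕ.^ m

record Field (c ℓ : Level) : Set (suc (c ⊔ ℓ)) where
  field
    commutativeRing : CommutativeRing c ℓ
  open CommutativeRing commutativeRing public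
  field
    1≉0     : ¬ (1# ≈ 0#)
    inverse : ∀ x → ¬ (x ≈ 0#) → Σ Carrier λ y → (x * y) ≈ 1#

record FiniteField (c ℓ : Level) (q : ℕ) : Set (suc (c ⊔ ℓ)) where
  field
    field′ : Field c ℓ
  open Field field′ public
  field
    enumeration : Inverse (P.setoid (Fin q)) setoid

module _ {c ℓ : Level} {q : ℕ} (F : FiniteField c ℓ q) where
  open FiniteField F

  pow : Carrier → ℕ → Carrier
  pow x zero      = 1#
  pow x (ℕ.suc n) = x * pow x n

  IsPermutation : (Carrier → Carrier) → Set (c ⊔ ℓ)
  IsPermutation f = Bijective _≈_ _≈_ f

  binomialFn : ℕ → ℕ → Carrier → Carrier → Carrier
  binomialFn n k a x = pow x n * (pow x k + a)

  -- x^n (x^k + a) is a nontrivial permutation binomial of 𝔽_q: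
  -- it permutes 𝔽_q, has two terms with nonzero coefficients (a ≠ 0), and
  -- its two terms x^(n+k), a x^n have positive degrees (n ≥ 1, hence n+k ≥ 1)
  -- that are incongruent modulo q-1 (i.e. q-1 does not divide k).
  NontrivialPermBinomial : ℕ → ℕ → Carrier → Set (c ⊔ ℓ)
  NontrivialPermBinomial n k a =
    IsPermutation (binomialFn n k a) × ¬ (a ≈ 0#) × n ≥ 1 × ¬ ((q ∸ 1) ∣ k)

-- Write N = q − 1 and d = gcd k N. Bézout gives α with k α ≡ d (mod N); then α is
-- a unit modulo N/d, and adding a suitable multiple of N/d turns it into an m coprime to N with
-- k m ≡ d (mod N). Since x ^ q = x on 𝔽_q, positive exponents only matter modulo N, so x ↦ x ^ m
-- is a permutation of 𝔽_q, and precomposing x^n (x^k + a) with it gives x^(n m) (x^d + a):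
-- a nontrivial permutation binomial of the excluded form.

module Submission where

open import Defs
open import Level using (Level)
open import Data.Nat.Base as ℕ using (ℕ; zero; suc; _∸_; _≥_; s≤s; z≤n)
import Data.Nat.Properties as ℕ
open import Data.Fin.Base as Fin using (Fin; punchIn)
open import Data.Fin.Properties as Fin using (punchInᵢ≢i)
open import Data.Fin.Permutation using (permutation)
open import Data.Product using (∃; ∃₂; _×_; _,_; proj₁; proj₂)
open import Data.Empty using (⊥)
open import Data.Vec.Functional using (Vector; removeAt; replicate)
open import Function.Base using (_∘_)
open import Function.Bundles using (Inverse; Injection)
open import Function.Properties.Inverse using (Inverse⇒Injection)
import Function.Construct.Symmetry as Symmetry
open import Algebra.Bundles using (CommutativeMonoid)
open import Relation.Nullary using (¬_; Dec; yes; no; contradiction)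
open import Relation.Nullary.Decidable using (via-injection)
open import Relation.Binary.Definitions using (Decidable)
open import Relation.Binary.Core using (_Preserves_⟶_)
open import Data.Nat.Divisibility using (_∣_; ∣-trans)
open import Data.Nat.GCD using (gcd; gcd-GCD; gcd[m,n]∣m; module Bézout)
import Relation.Binary.PropositionalEquality as ≡
open ≡ using (_≡_; _≢_)

module ModularArithmetic where
  open import Data.Nat.Base
  open import Data.Nat.Properties
  open import Data.Nat.Divisibility
  open import Data.Nat.GCD
  open import Data.Nat.Coprimality using (Coprime; coprime-divisor; coprime-+; coprime-Bézout; gcd≡1⇒coprime)
  open import Data.Nat.Induction using (<-rec)
  open import Data.Nat.Tactic.RingSolver using (solve)
  open import Data.Sum using (inj₁)
  open import Data.List.Base using ([]; _∷_)
  open import Relation.Binary.PropositionalEquality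
  open ≡-Reasoning

  infix 4 _≡_mod_
  _≡_mod_ : ℕ → ℕ → ℕ → Set
  a ≡ b mod N = ∃₂ λ i j → a + i * N ≡ b + j * N

  +-multiple-mod : ∀ {a b N} c → a ≡ b mod N → a + c * N ≡ b mod N
  +-multiple-mod {a} {b} {N} c (i , j , eq) = i , c + j , (begin
    a + c * N + i * N  ≡⟨ solve (a ∷ c ∷ N ∷ i ∷ []) ⟩
    a + i * N + c * N  ≡⟨ cong (_+ c * N) eq ⟩
    b + j * N + c * N  ≡⟨ solve (b ∷ c ∷ N ∷ j ∷ []) ⟩
    b + (c + j) * N    ∎)

  identity⇒≡-mod : ∀ {d k N} .{{_ : NonZero N}} → Bézout.Identity d k N → ∃ λ α → k * α ≡ d mod N
  identity⇒≡-mod {d} {k} {suc N₀} (Bézout.+- x y eq) = x , 0 , y , (begin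
    k * x + 0   ≡⟨ +-identityʳ (k * x) ⟩
    k * x       ≡⟨ *-comm k x ⟩
    x * k       ≡⟨ eq ⟨
    d + y * suc N₀ ∎)
  identity⇒≡-mod {d} {k} {suc N₀} (Bézout.-+ x y eq) = x * N₀ , d , y * N₀ , (begin
    k * (x * N₀) + d * suc N₀  ≡⟨ solve (k ∷ x ∷ N₀ ∷ d ∷ []) ⟩
    (d + x * k) * N₀ + d       ≡⟨ cong (λ z → z * N₀ + d) eq ⟩
    y * suc N₀ * N₀ + d        ≡⟨ solve (y ∷ N₀ ∷ d ∷ []) ⟩
    d + y * N₀ * suc N₀        ∎)

  coprime-to-cofactor : ∀ {d k α N′} .{{_ : NonZero d}} → d ∣ k → k * α ≡ d mod (N′ * d) → Coprime α N′
  coprime-to-cofactor {d} {k} {α} {N′} d∣k (i , j , eq) {c} (c∣α , c∣N′) =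
    ∣1⇒≡1 (*-cancelʳ-∣ d (subst (c * d ∣_) (sym (*-identityˡ d)) cd∣d))
    where
    cd∣N : c * d ∣ N′ * d
    cd∣N = *-monoˡ-∣ d c∣N′
    cd∣kα : c * d ∣ k * α
    cd∣kα = subst (c * d ∣_) (*-comm α k) (*-pres-∣ c∣α d∣k)
    cd∣d : c * d ∣ d
    cd∣d = ∣m+n∣m⇒∣n (subst (c * d ∣_) (trans eq (+-comm d _)) (∣m∣n⇒∣m+n cd∣kα (∣n⇒∣m*n i cd∣N))) (∣n⇒∣m*n j cd∣N)

  largest-coprime-divisor : ∀ u t .{{_ : NonZero t}} →
                ∃ λ s → Coprime s u × (∀ {g} → g ∣ t → Coprime g u → g ∣ s)
  largest-coprime-divisor u = <-rec P step
    where
    P : ℕ → Set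
    P t = .{{_ : NonZero t}} → ∃ λ s → Coprime s u × (∀ {g} → g ∣ t → Coprime g u → g ∣ s)
    step : ∀ t → (∀ {s} → s < t → P s) → P t
    step t rec with gcd t u in eq
    ... | zero = contradiction eq (gcd[m,n]≢0 t u (inj₁ (≢-nonZero⁻¹ t)))
    ... | 1 = t , gcd≡1⇒coprime eq , λ g∣t _ → g∣t
    ... | G@(2+ _) =
      let s′ , s′⊥u , s′-max = rec (quotient-< G∣t) {{quotient≢0 G∣t}}
      in s′ , s′⊥u , λ g∣t g⊥u →
           s′-max (coprime-divisor (g⊥G g⊥u) (subst (_ ∣_) (m∣n⇒n≡m*quotient G∣t) g∣t)) g⊥u
      where
      G∣t : G ∣ t
      G∣t = subst (_∣ t) eq (gcd[m,n]∣m t u)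
      g⊥G : ∀ {g} → Coprime g u → Coprime g G
      g⊥G g⊥u (c∣g , c∣G) = g⊥u (c∣g , ∣-trans c∣G (subst (_∣ u) eq (gcd[m,n]∣n t u)))

  *-shift-mod : ∀ a b {c N} → a * b ≡ c mod N → a * (N + b) ≡ c mod N
  *-shift-mod a b {c} {N} ab≡c =
    subst (λ z → z ≡ c mod N) distrib (+-multiple-mod a ab≡c)
    where
    distrib : a * b + a * N ≡ a * (N + b)
    distrib = solve (a ∷ b ∷ N ∷ [])

  -- Choosing t to be the largest divisor of N coprime to α, every common divisor of
  -- α + N′ t and N is coprime to α, hence divides t, hence divides α.
  coprime-lift : ∀ {α N′} N .{{_ : NonZero N}} → Coprime α N′ → ∃ λ t → Coprime (α + N′ * t) N
  coprime-lift {α} {N′} N α⊥N′ with t , t⊥α , t-max ← largest-coprime-divisor α N = t , m⊥N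
    where
    m⊥N : Coprime (α + N′ * t) N
    m⊥N {h} (h∣m , h∣N) = h⊥α (∣-refl , h∣α)
      where
      h⊥α : Coprime h α
      h⊥α {c} (c∣h , c∣α) = α⊥N′ (c∣α , coprime-divisor c⊥t (subst (c ∣_) (*-comm N′ t) c∣N′t))
        where
        c∣N′t : c ∣ N′ * t
        c∣N′t = ∣m+n∣m⇒∣n (∣-trans c∣h h∣m) c∣α
        c⊥t : Coprime c t
        c⊥t (e∣c , e∣t) = t⊥α (e∣t , ∣-trans e∣c c∣α)
      h∣α : h ∣ α
      h∣α = ∣m+n∣m⇒∣n (subst (h ∣_) (+-comm α (N′ * t)) h∣m) (∣n⇒∣m*n N′ (t-max h∣N h⊥α))

  coprime-multiplier : ∀ {d k N} .{{_ : NonZero d}} .{{_ : NonZero N}} →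
                       Bézout.Identity d k N → d ∣ k → d ∣ N →
                       ∃ λ m → Coprime m N × k * m ≡ d mod N
  coprime-multiplier {d} {k} {N} identity d∣k@(divides k′ k≡k′d) (divides N′ N≡N′d)
    with α , kα≡d ← identity⇒≡-mod identity
    with t , m⊥N ← coprime-lift {N′ = N′} N (coprime-to-cofactor d∣k (subst (λ z → k * α ≡ d mod z) N≡N′d kα≡d))
    = α + N′ * t , m⊥N , subst (λ z → z ≡ d mod N) (sym km≡) (+-multiple-mod (k′ * t) kα≡d)
    where
    km≡ : k * (α + N′ * t) ≡ k * α + k′ * t * N
    km≡ = begin
      k * (α + N′ * t)           ≡⟨ *-distribˡ-+ k α (N′ * t) ⟩
      k * α + k * (N′ * t)       ≡⟨ cong (λ z → k * α + z * (N′ * t)) k≡k′d ⟩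
      k * α + k′ * d * (N′ * t)  ≡⟨ solve (k ∷ α ∷ k′ ∷ d ∷ N′ ∷ t ∷ []) ⟩
      k * α + k′ * t * (N′ * d)  ≡⟨ cong (λ z → k * α + k′ * t * z) N≡N′d ⟨
      k * α + k′ * t * N         ∎

  invertible-multiplier : ∀ {d k N} .{{_ : NonZero d}} .{{_ : NonZero N}} →
                          Bézout.Identity d k N → d ∣ k → d ∣ N →
                          ∃₂ λ m m′ → m ≥ 1 × m′ ≥ 1 × k * m ≡ d mod N × m * m′ ≡ 1 mod N
  invertible-multiplier {k = k} {N} identity d∣k d∣N
    with m , m⊥N , km≡d ← coprime-multiplier identity d∣k d∣N
    with m′ , mm′≡1 ← identity⇒≡-mod (coprime-Bézout (coprime-+ m⊥N))
    = N + m , N + m′ , ≤-trans (>-nonZero⁻¹ N) (m≤m+n N m) , ≤-trans (>-nonZero⁻¹ N) (m≤m+n N m′) ,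
      *-shift-mod k m km≡d , *-shift-mod (N + m) m′ mm′≡1

open ModularArithmetic using (_≡_mod_; invertible-multiplier)

module _ {a ℓ} (M : CommutativeMonoid a ℓ) where
  open CommutativeMonoid M
  open import Algebra.Properties.CommutativeMonoid.Sum M using (sum; sum-remove; sum-cong-≋)
  open import Algebra.Properties.CommutativeSemigroup commutativeSemigroup using (x∙yz≈y∙xz)
  open import Relation.Binary.Reasoning.Setoid setoid

  sum-differAt : ∀ {n} {f g : Vector Carrier n} i → (∀ j → j ≢ i → f j ≈ g j) →
                 g i ∙ sum f ≈ f i ∙ sum g
  sum-differAt {suc n} {f} {g} i f≈g = begin
    g i ∙ sum f                           ≈⟨ ∙-congˡ (sum-remove f) ⟩
    g i ∙ (f i ∙ sum (removeAt f i))      ≈⟨ x∙yz≈y∙xz (g i) (f i) _ ⟩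
    f i ∙ (g i ∙ sum (removeAt f i))      ≈⟨ ∙-congˡ (∙-congˡ (sum-cong-≋ (λ j → f≈g (punchIn i j) (punchInᵢ≢i i j)))) ⟩
    f i ∙ (g i ∙ sum (removeAt g i))      ≈⟨ ∙-congˡ (sum-remove g) ⟨
    f i ∙ sum g                           ∎

distinct⇒≥2 : ∀ {n} {i j : Fin n} → i ≢ j → n ≥ 2
distinct⇒≥2 {suc zero} {Fin.zero} {Fin.zero} i≢j = contradiction ≡.refl i≢j
distinct⇒≥2 {suc (suc n)} _ = s≤s (s≤s z≤n)

module FiniteFieldProperties {c ℓ} {q : ℕ} (F : FiniteField c ℓ q) where
  open FiniteField F
  open import Algebra.Properties.CommutativeMonoid.Sum *-commutativeMonoid
    using (sum-cong-≋; sum-permute; ∑-distrib-+; sum-replicate) renaming (sum to ∏)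
  open import Algebra.Properties.Semiring.Exp semiring public using (_^_; ^-congˡ)
  open import Algebra.Properties.Semiring.Exp semiring using (^-homo-*; ^-assocʳ)
  open import Relation.Binary.Reasoning.Setoid setoid

  _≉0 : Carrier → Set ℓ
  x ≉0 = ¬ x ≈ 0#

  *-cancelʳ : ∀ {x y z} → z ≉0 → x * z ≈ y * z → x ≈ y
  *-cancelʳ {x} {y} {z} z≉0 xz≈yz = begin
    x                 ≈⟨ *-identityʳ x ⟨
    x * 1#            ≈⟨ *-congˡ z*z⁻¹≈1 ⟨
    x * (z * z⁻¹)     ≈⟨ *-assoc x z z⁻¹ ⟨
    x * z * z⁻¹       ≈⟨ *-congʳ xz≈yz ⟩
    y * z * z⁻¹       ≈⟨ *-assoc y z z⁻¹ ⟩
    y * (z * z⁻¹)     ≈⟨ *-congˡ z*z⁻¹≈1 ⟩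
    y * 1#            ≈⟨ *-identityʳ y ⟩
    y                 ∎
    where
    z⁻¹ = proj₁ (inverse z z≉0)
    z*z⁻¹≈1 = proj₂ (inverse z z≉0)

  *-nonzero : ∀ {x y} → x ≉0 → y ≉0 → (x * y) ≉0
  *-nonzero {x} {y} x≉0 y≉0 xy≈0 = y≉0 (*-cancelʳ x≉0 (trans (*-comm y x) (trans xy≈0 (sym (zeroˡ x)))))

  ∏-nonzero : ∀ {n} (f : Vector Carrier n) → (∀ i → f i ≉0) → ∏ f ≉0
  ∏-nonzero {zero}  f _    = 1≉0
  ∏-nonzero {suc n} f f≉0 = *-nonzero (f≉0 Fin.zero) (∏-nonzero (f ∘ Fin.suc) (f≉0 ∘ Fin.suc))

  private
    E : Fin q → Carrier
    E = Inverse.to enumeration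
    D : Carrier → Fin q
    D = Inverse.from enumeration

  E∘D : ∀ x → E (D x) ≈ x
  E∘D x = Inverse.inverseˡ enumeration ≡.refl

  D∘E : ∀ i → D (E i) ≡ i
  D∘E i = Inverse.inverseʳ enumeration refl

  D-cong : ∀ {x y} → x ≈ y → D x ≡ D y
  D-cong = Inverse.from-cong enumeration

  private
    D-injection = Inverse⇒Injection (Symmetry.inverse enumeration)

  D-injective : ∀ {x y} → D x ≡ D y → x ≈ y
  D-injective = Injection.injective D-injection

  _≟_ : Decidable _≈_
  _≟_ = via-injection D-injection Fin._≟_

  q≥2 : q ≥ 2
  q≥2 = distinct⇒≥2 (λ D0≡D1 → 1≉0 (sym (D-injective D0≡D1)))

  q∸1≥1 : q ∸ 1 ≥ 1
  q∸1≥1 = ℕ.∸-monoˡ-≤ 1 q≥2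

  q≡suc[q∸1] : q ≡ suc (q ∸ 1)
  q≡suc[q∸1] = ≡.sym (≡.trans (ℕ.+-comm 1 (q ∸ 1)) (ℕ.m∸n+n≡m (ℕ.≤-trans (ℕ.n≤1+n 1) q≥2)))

  0↦1 : Carrier → Carrier
  0↦1 x with x ≟ 0#
  ... | yes _ = 1#
  ... | no  _ = x

  0↦1-zero : ∀ {x} → x ≈ 0# → 0↦1 x ≈ 1#
  0↦1-zero {x} x≈0 with x ≟ 0#
  ... | yes _   = refl
  ... | no  x≉0 = contradiction x≈0 x≉0

  0↦1-nonzero : ∀ {x} → x ≉0 → 0↦1 x ≈ x
  0↦1-nonzero {x} x≉0 with x ≟ 0#
  ... | yes x≈0 = contradiction x≈0 x≉0
  ... | no  _   = refl

  0↦1≉0 : ∀ x → 0↦1 x ≉0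
  0↦1≉0 x with x ≟ 0#
  ... | yes _   = 1≉0
  ... | no  x≉0 = x≉0

  0↦1-cong : 0↦1 Preserves _≈_ ⟶ _≈_
  0↦1-cong {x} {y} x≈y = by-cases (x ≟ 0#)
    where
    by-cases : Dec (x ≈ 0#) → 0↦1 x ≈ 0↦1 y
    by-cases (yes x≈0) = trans (0↦1-zero x≈0) (sym (0↦1-zero (trans (sym x≈y) x≈0)))
    by-cases (no x≉0)  = trans (0↦1-nonzero x≉0) (trans x≈y (sym (0↦1-nonzero (x≉0 ∘ trans x≈y))))

  private
    D-scale-cancel : ∀ {x y} → x * y ≈ 1# → ∀ j → D (x * E (D (y * E j))) ≡ j
    D-scale-cancel {x} {y} xy≈1 j = ≡.trans (D-cong x*[y*Ej]≈Ej) (D∘E j)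
      where
      x*[y*Ej]≈Ej : x * E (D (y * E j)) ≈ E j
      x*[y*Ej]≈Ej = begin
        x * E (D (y * E j))  ≈⟨ *-congˡ (E∘D (y * E j)) ⟩
        x * (y * E j)        ≈⟨ *-assoc x y (E j) ⟨
        x * y * E j          ≈⟨ *-congʳ xy≈1 ⟩
        1# * E j             ≈⟨ *-identityˡ (E j) ⟩
        E j                  ∎

  ∏-scale-invariant : ∀ {x} → x ≉0 → (f : Carrier → Carrier) → f Preserves _≈_ ⟶ _≈_ →
                      ∏ (f ∘ E) ≈ ∏ (λ i → f (x * E i))
  ∏-scale-invariant {x} x≉0 f f-cong = begin
    ∏ (f ∘ E)                        ≈⟨ sum-permute (f ∘ E) π ⟩
    ∏ (λ i → f (E (D (x * E i))))    ≈⟨ sum-cong-≋ (λ i → f-cong (E∘D (x * E i))) ⟩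
    ∏ (λ i → f (x * E i))            ∎
    where
    x⁻¹ = proj₁ (inverse x x≉0)
    x*x⁻¹≈1 = proj₂ (inverse x x≉0)
    π = permutation (λ i → D (x * E i)) (λ i → D (x⁻¹ * E i))
          (D-scale-cancel x*x⁻¹≈1) (D-scale-cancel (trans (*-comm x⁻¹ x) x*x⁻¹≈1))

  -- Multiplication by x ≉ 0 permutes the field; comparing the products of 0↦1 (nonzero by
  -- construction) over all elements before and after scaling gives x ^ q ≈ x.
  x^q≈x : ∀ x → x ^ q ≈ x
  x^q≈x x with x ≟ 0#
  ... | yes x≈0 = begin
    x ^ q              ≡⟨ ≡.cong (x ^_) q≡suc[q∸1] ⟩
    x * x ^ (q ∸ 1)    ≈⟨ *-congʳ x≈0 ⟩
    0# * x ^ (q ∸ 1)   ≈⟨ zeroˡ _ ⟩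
    0#                 ≈⟨ x≈0 ⟨
    x                  ∎
  ... | no x≉0 = *-cancelʳ (∏-nonzero (0↦1 ∘ E) (0↦1≉0 ∘ E)) (begin
    x ^ q * ∏ (0↦1 ∘ E)                ≈⟨ *-congʳ (sum-replicate q {x}) ⟨
    ∏ (replicate q x) * ∏ (0↦1 ∘ E)   ≈⟨ ∑-distrib-+ (replicate q x) (0↦1 ∘ E) ⟨
    ∏ f                                ≈⟨ *-identityˡ (∏ f) ⟨
    1# * ∏ f                           ≈⟨ *-congʳ (0↦1-zero (trans (*-congˡ (E∘D 0#)) (zeroʳ x))) ⟨
    g (D 0#) * ∏ f                     ≈⟨ sum-differAt *-commutativeMonoid (D 0#) f≈g ⟩
    f (D 0#) * ∏ g                     ≈⟨ *-cong (*-congˡ (0↦1-zero (E∘D 0#))) (sym (∏-scale-invariant x≉0 0↦1 0↦1-cong)) ⟩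
    x * 1# * ∏ (0↦1 ∘ E)               ≈⟨ *-congʳ (*-identityʳ x) ⟩
    x * ∏ (0↦1 ∘ E)                    ∎)
    where
    f g : Vector Carrier q
    f i = x * 0↦1 (E i)
    g i = 0↦1 (x * E i)
    f≈g : ∀ j → j ≢ D 0# → f j ≈ g j
    f≈g j j≢D0 = trans (*-congˡ (0↦1-nonzero Ej≉0)) (sym (0↦1-nonzero (*-nonzero x≉0 Ej≉0)))
      where
      Ej≉0 : E j ≉0
      Ej≉0 Ej≈0 = j≢D0 (≡.trans (≡.sym (D∘E j)) (D-cong Ej≈0))

  ^-+-period : ∀ x a → x ^ (suc a ℕ.+ (q ∸ 1)) ≈ x ^ suc a
  ^-+-period x a = begin
    x ^ (suc a ℕ.+ (q ∸ 1))    ≡⟨ ≡.cong (x ^_) (ℕ.+-suc a (q ∸ 1)) ⟨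
    x ^ (a ℕ.+ suc (q ∸ 1))    ≈⟨ ^-homo-* x a (suc (q ∸ 1)) ⟩
    x ^ a * x ^ suc (q ∸ 1)    ≡⟨ ≡.cong (λ n → x ^ a * x ^ n) q≡suc[q∸1] ⟨
    x ^ a * x ^ q              ≈⟨ *-congˡ (x^q≈x x) ⟩
    x ^ a * x                  ≈⟨ *-comm (x ^ a) x ⟩
    x ^ suc a                  ∎

  ^-+-multiple : ∀ x a i → x ^ (suc a ℕ.+ i ℕ.* (q ∸ 1)) ≈ x ^ suc a
  ^-+-multiple x a zero    = reflexive (≡.cong (λ n → x ^ suc n) (ℕ.+-identityʳ a))
  ^-+-multiple x a (suc i) = begin
    x ^ (suc a ℕ.+ (q ∸ 1 ℕ.+ i ℕ.* (q ∸ 1)))    ≡⟨ ≡.cong (λ n → x ^ suc n) rearrange ⟩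
    x ^ (suc (a ℕ.+ i ℕ.* (q ∸ 1)) ℕ.+ (q ∸ 1))  ≈⟨ ^-+-period x (a ℕ.+ i ℕ.* (q ∸ 1)) ⟩
    x ^ suc (a ℕ.+ i ℕ.* (q ∸ 1))                ≈⟨ ^-+-multiple x a i ⟩
    x ^ suc a                                    ∎
    where
    rearrange : a ℕ.+ (q ∸ 1 ℕ.+ i ℕ.* (q ∸ 1)) ≡ a ℕ.+ i ℕ.* (q ∸ 1) ℕ.+ (q ∸ 1)
    rearrange = ≡.trans (≡.cong (a ℕ.+_) (ℕ.+-comm (q ∸ 1) _)) (≡.sym (ℕ.+-assoc a _ (q ∸ 1)))

  ^-mod : ∀ x {a b} → a ≥ 1 → b ≥ 1 → a ≡ b mod (q ∸ 1) → x ^ a ≈ x ^ b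
  ^-mod x {suc a} {suc b} _ _ (i , j , eq) = begin
    x ^ suc a                        ≈⟨ ^-+-multiple x a i ⟨
    x ^ (suc a ℕ.+ i ℕ.* (q ∸ 1))    ≡⟨ ≡.cong (x ^_) eq ⟩
    x ^ (suc b ℕ.+ j ℕ.* (q ∸ 1))    ≈⟨ ^-+-multiple x b j ⟩
    x ^ suc b                        ∎

  ^-inverse : ∀ {m m′} → m ≥ 1 → m′ ≥ 1 → m ℕ.* m′ ≡ 1 mod (q ∸ 1) → ∀ x → (x ^ m) ^ m′ ≈ x
  ^-inverse {m} {m′} m≥1 m′≥1 mm′≡1 x = begin
    (x ^ m) ^ m′     ≈⟨ ^-assocʳ x m m′ ⟩
    x ^ (m ℕ.* m′)   ≈⟨ ^-mod x (ℕ.*-mono-≤ m≥1 m′≥1) ℕ.≤-refl mm′≡1 ⟩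
    x * 1#           ≈⟨ *-identityʳ x ⟩
    x                ∎

  pow≡^ : ∀ x n → pow F x n ≡ x ^ n
  pow≡^ x zero    = ≡.refl
  pow≡^ x (suc n) = ≡.cong (x *_) (pow≡^ x n)

  binomialFn-^ : ∀ n {k d m} a → k ℕ.* m ≥ 1 → d ≥ 1 → k ℕ.* m ≡ d mod (q ∸ 1) →
                 ∀ x → binomialFn F (n ℕ.* m) d a x ≈ binomialFn F n k a (x ^ m)
  binomialFn-^ n {k} {d} {m} a km≥1 d≥1 km≡d x = begin
    pow F x (n ℕ.* m) * (pow F x d + a)        ≡⟨ ≡.cong₂ (λ u v → u * (v + a)) (pow≡^ x (n ℕ.* m)) (pow≡^ x d) ⟩
    x ^ (n ℕ.* m) * (x ^ d + a)                ≈⟨ *-cong (^-swap n) (+-congʳ x^d≈) ⟩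
    (x ^ m) ^ n * ((x ^ m) ^ k + a)            ≡⟨ ≡.cong₂ (λ u v → u * (v + a)) (pow≡^ (x ^ m) n) (pow≡^ (x ^ m) k) ⟨
    pow F (x ^ m) n * (pow F (x ^ m) k + a)    ∎
    where
    ^-swap : ∀ e → x ^ (e ℕ.* m) ≈ (x ^ m) ^ e
    ^-swap e = trans (reflexive (≡.cong (x ^_) (ℕ.*-comm e m))) (sym (^-assocʳ x m e))
    x^d≈ : x ^ d ≈ (x ^ m) ^ k
    x^d≈ = trans (sym (^-mod x km≥1 d≥1 km≡d)) (^-swap k)

  isPermutation-precompose : ∀ {f g σ τ : Carrier → Carrier} → IsPermutation F f →
    σ Preserves _≈_ ⟶ _≈_ → τ Preserves _≈_ ⟶ _≈_ → (∀ x → τ (σ x) ≈ x) → (∀ y → σ (τ y) ≈ y) →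
    (∀ x → g x ≈ f (σ x)) → IsPermutation F g
  isPermutation-precompose {f} {g} {σ} {τ} (f-injective , f-surjective) σ-cong τ-cong τσ≈id στ≈id g≈fσ =
    g-injective , g-surjective
    where
    g-injective : ∀ {x y} → g x ≈ g y → x ≈ y
    g-injective {x} {y} gx≈gy = begin
      x          ≈⟨ τσ≈id x ⟨
      τ (σ x)    ≈⟨ τ-cong (f-injective (trans (sym (g≈fσ x)) (trans gx≈gy (g≈fσ y)))) ⟩
      τ (σ y)    ≈⟨ τσ≈id y ⟩
      y          ∎
    g-surjective : ∀ y → ∃ λ x → ∀ {w} → w ≈ x → g w ≈ y
    g-surjective y with z , fz≈y ← f-surjective y =
      τ z , λ w≈τz → trans (g≈fσ _) (fz≈y (trans (σ-cong w≈τz) (στ≈id z)))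

open FiniteFieldProperties using (q∸1≥1; ^-congˡ; ^-inverse; binomialFn-^; isPermutation-precompose)

lemma2p2 : ∀ {c ℓ : Level} (q : ℕ) → IsPrimePower q → (F : FiniteField c ℓ q) →
    (d : ℕ) → d ≥ 1 → d ∣ (q ∸ 1) →
    (∀ (e : ℕ) (a : FiniteField.Carrier F) → ¬ NontrivialPermBinomial F e d a) →
    ∀ (n k : ℕ) (a : FiniteField.Carrier F) → k ≥ 1 → gcd k (q ∸ 1) ≡ d →
      ¬ NontrivialPermBinomial F n k a
lemma2p2 q _ F d d≥1 d∣N noBinomial n k a k≥1 gcd≡d (f-perm , a≉0 , n≥1 , N∤k) =
  conclude (invertible-multiplier identity d∣k d∣N)
  where
  instance
    _ = ℕ.>-nonZero d≥1
    _ = ℕ.>-nonZero (q∸1≥1 F)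
  identity : Bézout.Identity d k (q ∸ 1)
  identity = ≡.subst (λ e → Bézout.Identity e k (q ∸ 1)) gcd≡d (Bézout.identity (gcd-GCD k (q ∸ 1)))
  d∣k : d ∣ k
  d∣k = ≡.subst (_∣ k) gcd≡d (gcd[m,n]∣m k (q ∸ 1))
  conclude : (∃₂ λ m m′ → m ≥ 1 × m′ ≥ 1 × k ℕ.* m ≡ d mod (q ∸ 1) × m ℕ.* m′ ≡ 1 mod (q ∸ 1)) → ⊥
  conclude (m , m′ , m≥1 , m′≥1 , km≡d , mm′≡1) =
    noBinomial (n ℕ.* m) a (g-perm , a≉0 , ℕ.*-mono-≤ n≥1 m≥1 , N∤k ∘ (λ N∣d → ∣-trans N∣d d∣k))
    where
    m′m≡1 : m′ ℕ.* m ≡ 1 mod (q ∸ 1)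
    m′m≡1 = ≡.subst (λ e → e ≡ 1 mod (q ∸ 1)) (ℕ.*-comm m m′) mm′≡1
    g-perm : IsPermutation F (binomialFn F (n ℕ.* m) d a)
    g-perm = isPermutation-precompose F f-perm (^-congˡ F m) (^-congˡ F m′)
               (^-inverse F m≥1 m′≥1 mm′≡1) (^-inverse F m′≥1 m≥1 m′m≡1)
               (binomialFn-^ F n {k} {d} {m} a (ℕ.*-mono-≤ k≥1 m≥1) d≥1 km≡d)
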